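{- Let $\Sigma$ be an aggregate signature, $\mathcal D$ a $\Sigma$-structure, $\Pi$ a set of defined predicate symbols and $P$ a definite $\Sigma(\Pi)$-aggregate program. Then $P$ has a two-valued $ult$-well-founded model $(M,M)$, $M$ is the unique $ult$-stable model of $P$, and $M$ is the least fixpoint of $T_{P,\mathcal D}$.
   Context: Aggregates: an aggregate relation is $R\subseteq\mathcal P(D_1)\times D_2$; it is monotone if $(S_1,d)\in R$, $S_1\subseteq S_2$ imply $(S_2,d)\in R$, anti-monotone if $(S_2,d)\in R$, $S_1\subseteq S_2$ imply $(S_1,d)\in R$. An aggregate signature $\Sigma$ has sorts, sorted function, predicate and aggregate symbols $\mathsf R:\{s_1\times\dots\times s_n\}\times w$. Set expressions $\{(x_1,\dots,x_n)\mid\varphi\}$, aggregate atoms $\mathsf R(s,t)$ and aggregate formulas (atoms, aggregate atoms, closed under $\neg,\wedge,\vee,\forall,\exists$) are defined simultaneously. A $\Sigma$-structure interprets symbols as usual, aggregate symbols by aggregate relations; the value of $\{\bar x\mid\varphi(\bar x)\}$ is $\{\bar d\mid \mathcal D\models\varphi(\bar d)\}$ and $\mathsf R(s,t)$ holds iff (value of $s$, value of $t$) $\in\mathsf R^{\mathcal D}$. Programs: $\Pi$ is a set of predicate symbols not in $\Sigma$; a rule is $A\leftarrow\varphi$, $A$ an atom with predicate in $\Pi$, $\varphi$ a $\Sigma(\Pi)$-aggregate formula; a program is a set of rules. Interpretations are subsets $I$ of $base_{\mathcal D}(\Pi)$ (ground atoms of $\Pi$ over domain elements), ordered by $\subseteq$;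 $\mathcal D(I)$ makes exactly the atoms in $I$ true. $inst_{\mathcal D}(P)$ is the set of ground instances of rules of $P$ (domain elements substituted for free variables, head terms evaluated). $T_{P,\mathcal D}(I)=\{A\mid A\leftarrow\varphi\in inst_{\mathcal D}(P),\ \mathcal D(I)\models\varphi\}$. Definite programs: an occurrence of a predicate in a formula is neutral if it lies inside the condition $\theta$ of an aggregate atom $\mathsf R(\{\bar x\mid\theta\},t)$ with $\mathsf R^{\mathcal D}$ neither monotone nor anti-monotone; otherwise it is positive (resp. negative) if the number of negations and of aggregate atoms interpreted by anti-monotone aggregate relations above it is even (resp. odd). A formula is positive if no predicate of $\Pi$ occurs negatively or neutrally in it. A definite aggregate program is one whose rule bodies are all positive. Three-valued semantics: $\mathbf{THREE}=\{(\mathbf f,\mathbf f),(\mathbf f,\mathbf t),(\mathbf t,\mathbf t)\}$ (false, unknown, true), truth order componentwise with meet $\wedge$ and join $\vee$, $\neg(x,y)=(\neg y,\neg x)$. A three-valued set is a pair $(S_1,S_2)$ with $S_1\subseteq S_2$. For an aggregate relation $R$, $ult(R)$ maps $((S_1,S_2),d)$ to $(x,y)$ with $x=\mathbf t$ iff $(S,d)\in R$ for all $S$ with $S_1\subseteq S\subseteq S_2$, and $y=\mathbf t$ iff $(S,d)\in R$ for some such $S$. A three-valued interpretation is a pair $(I_1,I_2)$ of interpretations, $I_1\subseteq I_2$, giving defined atom $A$ the value $(A\in I_1,A\in I_2)$. The value $\mathcal H_{ult(I_1,I_2)}(\varphi)$ of a closed formula: $\Sigma$-atoms as in $\mathcal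 D$, defined atoms by $(I_1,I_2)$, connectives and quantifiers by the $\mathbf{THREE}$ operations (quantifiers as join/meet over domain), a set expression $\{\bar x\mid\psi\}$ evaluates to $(S_1,S_2)$ where $S_1$ (resp. $S_2$) is the set of tuples with $\psi(\bar d)$ true (resp. not false), and $\mathsf R(s,t)$ evaluates to $ult(\mathsf R^{\mathcal D})$ applied to the values. $\Phi_{P,ult}(I_1,I_2)$ assigns each $A\in base_{\mathcal D}(\Pi)$ the join of the values of bodies of rules $A\leftarrow\varphi\in inst_{\mathcal D}(P)$ (false if none). The $ult$-well-founded model and $ult$-stable models are the well-founded fixpoint and exact stable fixpoints of $\Phi_{P,ult}$, where for an operator $A$ on pairs $(x,y)$, $x\le y$, of a complete lattice: $A^\downarrow(b)=\mathrm{glb}\{x\le b\mid A^1(x,b)\le x\}$, $A^\uparrow(a)=\mathrm{glb}\{x\ge a\mid A^2(a,x)\le x\}$, $\mathcal S_A(a,b)=(A^\downarrow(b),A^\uparrow(a))$; the well-founded fixpoint is the least fixpoint in the precision order ($(x,y)\le_p(x',y')$ iff $x\le x'$, $y'\le y$) of $\mathcal S_A$ on the pairs $(a,b)$ with $(a,b)\le_p A(a,b)$ and $a\le A^\downarrow(b)$; an exact stable fixpoint is an $x$ with $\mathcal S_A(x,x)=(x,x)$. -}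

module Defs where

open import Level using (0ℓ)
open import Data.Bool using (Bool; true; false)
open import Data.List using (List; []; _∷_; _++_)
open import Data.List.Membership.Propositional using (_∈_)
open import Data.List.Relation.Unary.All using (All; []; _∷_; lookup)
open import Data.List.Relation.Unary.All.Properties using (++⁺)
open import Data.Product using (Σ; ∃; _×_; _,_; proj₁; proj₂)
open import Data.Sum using (_⊎_)
open import Relation.Nullary using (¬_; does)
open import Relation.Binary.PropositionalEquality using (_≡_)
open import Axiom.ExcludedMiddle using (ExcludedMiddle)

record Signature : Set₁ where
  field
    Sort : Set
    Fun  : List Sort → Sort → Set
    Pred : List Sort → Set
    -- aggregate symbol R : {s₁ × … × sₙ} × w
    Agg  : List Sort → Sort → Set

-- Subsets (classical powerset: characteristic functions) and
-- aggregate relations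

_⊆ᵇ_ : {A : Set} → (A → Bool) → (A → Bool) → Set
S₁ ⊆ᵇ S₂ = ∀ a → S₁ a ≡ true → S₂ a ≡ true

AggRel : Set → Set → Set₁
AggRel D₁ D₂ = (D₁ → Bool) → D₂ → Set

Monotone : {D₁ D₂ : Set} → AggRel D₁ D₂ → Set
Monotone R = ∀ S₁ S₂ d → R S₁ d → S₁ ⊆ᵇ S₂ → R S₂ d

AntiMonotone : {D₁ D₂ : Set} → AggRel D₁ D₂ → Set
AntiMonotone R = ∀ S₁ S₂ d → R S₂ d → S₁ ⊆ᵇ S₂ → R S₁ d

module _ (Sg : Signature) where
  open Signature Sg

  record Structure : Set₁ where
    field
      Dom  : Sort → Set
      fun  : ∀ {ss s} → Fun ss s → All Dom ss → Dom s
      pred : ∀ {ss} → Pred ss → All Dom ss → Set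
      agg  : ∀ {ss w} → Agg ss w → AggRel (All Dom ss) (Dom w)
      -- aggregate relations are relations on *sets*: they do not
      -- distinguish extensionally equal characteristic functions
      agg-ext : ∀ {ss w} (R : Agg ss w) S₁ S₂ d →
                (∀ x → S₁ x ≡ S₂ x) → agg R S₁ d → agg R S₂ d

-- Syntax of Σ(Π)-aggregate formulas (typed de Bruijn variables)

module Syntax (Sg : Signature) (Π : List (Signature.Sort Sg) → Set) where
  open Signature Sg

  Ctx : Set
  Ctx = List Sort

  mutual
    data Term (Γ : Ctx) : Sort → Set where
      var : ∀ {s} → s ∈ Γ → Term Γ s
      app : ∀ {ss s} → Fun ss s → Terms Γ ss → Term Γ s

    data Terms (Γ : Ctx) : List Sort → Set where
      []  : Terms Γ []
      _∷_ : ∀ {s ss} → Term Γ s → Terms Γ ss → Terms Γ (s ∷ ss)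

  mutual
    -- set expression {(x₁,…,xₙ) ∣ φ}; the bound variables come first
    data SetExp (Γ : Ctx) (ss : List Sort) : Set where
      ⟨_⟩ : Formula (ss ++ Γ) → SetExp Γ ss

    data Formula (Γ : Ctx) : Set where
      atom    : ∀ {ss} → Pred ss → Terms Γ ss → Formula Γ
      defAtom : ∀ {ss} → Π ss → Terms Γ ss → Formula Γ
      aggAtom : ∀ {ss w} → Agg ss w → SetExp Γ ss → Term Γ w → Formula Γ
      neg     : Formula Γ → Formula Γ
      and     : Formula Γ → Formula Γ → Formula Γ
      or      : Formula Γ → Formula Γ → Formula Γ
      all     : (s : Sort) → Formula (s ∷ Γ) → Formula Γ
      ex      : (s : Sort) → Formula (s ∷ Γ) → Formula Γ

  record Rule : Set where
    constructor rule
    field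
      ctx  : Ctx
      {hs} : List Sort
      hp   : Π hs
      hargs : Terms ctx hs
      body : Formula ctx

  Program : Set₁
  Program = Rule → Set

  module Polarity (D : Structure Sg) where
    open Structure D

    data NoDef {Γ : Ctx} : Formula Γ → Set where
      atom : ∀ {ss} (p : Pred ss) ts → NoDef (atom p ts)
      aggN : ∀ {ss w} (R : Agg ss w) {ψ} t → NoDef ψ → NoDef (aggAtom R ⟨ ψ ⟩ t)
      neg  : ∀ {φ} → NoDef φ → NoDef (neg φ)
      and  : ∀ {φ ψ} → NoDef φ → NoDef ψ → NoDef (and φ ψ)
      or   : ∀ {φ ψ} → NoDef φ → NoDef ψ → NoDef (or φ ψ)
      all  : ∀ s {φ} → NoDef φ → NoDef (all s φ)
      ex   : ∀ s {φ} → NoDef φ → NoDef (ex s φ)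

    mutual
      -- Pos φ : no predicate of Π occurs negatively or neutrally in φ
      data Pos {Γ : Ctx} : Formula Γ → Set where
        atom : ∀ {ss} (p : Pred ss) ts → Pos (atom p ts)
        def  : ∀ {ss} (p : Π ss) ts → Pos (defAtom p ts)
        aggAnti : ∀ {ss w} (R : Agg ss w) {ψ} t →
                  AntiMonotone (agg R) → Neg ψ → Pos (aggAtom R ⟨ ψ ⟩ t)
        aggMono : ∀ {ss w} (R : Agg ss w) {ψ} t →
                  ¬ AntiMonotone (agg R) → Monotone (agg R) → Pos ψ →
                  Pos (aggAtom R ⟨ ψ ⟩ t)
        aggNeutral : ∀ {ss w} (R : Agg ss w) {ψ} t →
                  ¬ AntiMonotone (agg R) → ¬ Monotone (agg R) → NoDef ψ →
                  Pos (aggAtom R ⟨ ψ ⟩ t)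
        neg  : ∀ {φ} → Neg φ → Pos (neg φ)
        and  : ∀ {φ ψ} → Pos φ → Pos ψ → Pos (and φ ψ)
        or   : ∀ {φ ψ} → Pos φ → Pos ψ → Pos (or φ ψ)
        all  : ∀ s {φ} → Pos φ → Pos (all s φ)
        ex   : ∀ s {φ} → Pos φ → Pos (ex s φ)

      -- Neg φ : no predicate of Π occurs positively or neutrally in φ
      data Neg {Γ : Ctx} : Formula Γ → Set where
        atom : ∀ {ss} (p : Pred ss) ts → Neg (atom p ts)
        aggAnti : ∀ {ss w} (R : Agg ss w) {ψ} t →
                  AntiMonotone (agg R) → Pos ψ → Neg (aggAtom R ⟨ ψ ⟩ t)
        aggMono : ∀ {ss w} (R : Agg ss w) {ψ} t →
                  ¬ AntiMonotone (agg R) → Monotone (agg R) → Neg ψ →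
                  Neg (aggAtom R ⟨ ψ ⟩ t)
        aggNeutral : ∀ {ss w} (R : Agg ss w) {ψ} t →
                  ¬ AntiMonotone (agg R) → ¬ Monotone (agg R) → NoDef ψ →
                  Neg (aggAtom R ⟨ ψ ⟩ t)
        neg  : ∀ {φ} → Pos φ → Neg (neg φ)
        and  : ∀ {φ ψ} → Neg φ → Neg ψ → Neg (and φ ψ)
        or   : ∀ {φ ψ} → Neg φ → Neg ψ → Neg (or φ ψ)
        all  : ∀ s {φ} → Neg φ → Neg (all s φ)
        ex   : ∀ s {φ} → Neg φ → Neg (ex s φ)

    Definite : Program → Set
    Definite P = ∀ r → P r → Pos (Rule.body r)

-- Semantics (classical: parameterised by excluded middle, used to form
-- the characteristic functions of sets defined by formulas)

module Semantics (Sg : Signature) (Π : List (Signature.Sort Sg) → Set)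
                 (D : Structure Sg) (lem : ExcludedMiddle 0ℓ) where
  open Signature Sg
  open Syntax Sg Π
  open Structure D

  ⌊_⌋ : Set → Bool
  ⌊ A ⌋ = does (lem {A})

  Env : Ctx → Set
  Env Γ = All Dom Γ

  mutual
    evalT : ∀ {Γ s} → Term Γ s → Env Γ → Dom s
    evalT (var x) ρ = lookup ρ x
    evalT (app f ts) ρ = fun f (evalTs ts ρ)

    evalTs : ∀ {Γ ss} → Terms Γ ss → Env Γ → All Dom ss
    evalTs [] ρ = []
    evalTs (t ∷ ts) ρ = evalT t ρ ∷ evalTs ts ρ

  Base : Set
  Base = Σ (List Sort) λ ss → Π ss × All Dom ss

  Interp : Set
  Interp = Base → Bool

  _⊆_ : Interp → Interp → Set
  I ⊆ J = I ⊆ᵇ J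

  _≐_ : Interp → Interp → Set
  I ≐ J = ∀ A → I A ≡ J A

  -- predicates (possibly not given by characteristic functions)
  _⊆ₚ_ : (Base → Set) → (Base → Set) → Set
  X ⊆ₚ Y = ∀ A → X A → Y A

  _≐ₚ_ : (Base → Set) → (Base → Set) → Set
  X ≐ₚ Y = X ⊆ₚ Y × Y ⊆ₚ X

  ⌜_⌝ : Interp → Base → Set
  ⌜ I ⌝ A = I A ≡ true

  head : (r : Rule) → Env (Rule.ctx r) → Base
  head r ρ = Rule.hs r , Rule.hp r , evalTs (Rule.hargs r) ρ

  sat : Interp → ∀ {Γ} → Formula Γ → Env Γ → Set
  sat I (atom p ts) ρ = pred p (evalTs ts ρ)
  sat I (defAtom {ss} p ts) ρ = I (ss , p , evalTs ts ρ) ≡ true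
  sat I (aggAtom R ⟨ ψ ⟩ t) ρ =
    agg R (λ ds → ⌊ sat I ψ (++⁺ ds ρ) ⌋) (evalT t ρ)
  sat I (neg φ) ρ = ¬ sat I φ ρ
  sat I (and φ ψ) ρ = sat I φ ρ × sat I ψ ρ
  sat I (or φ ψ) ρ = sat I φ ρ ⊎ sat I ψ ρ
  sat I (all s φ) ρ = ∀ (d : Dom s) → sat I φ (d ∷ ρ)
  sat I (ex s φ) ρ = Σ (Dom s) λ d → sat I φ (d ∷ ρ)

  T : Program → Interp → Interp
  T P I A = ⌊ Σ Rule (λ r → P r × Σ (Env (Rule.ctx r)) λ ρ →
                head r ρ ≡ A × sat I (Rule.body r) ρ) ⌋

  -- three-valued semantics: a truth value (x , y) ∈ THREE is a pair of
  -- propositions, x = "is true", y = "is not false"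

  ult : ∀ {D₁ D₂ : Set} → AggRel D₁ D₂ → (D₁ → Bool) → (D₁ → Bool) → D₂ → Set × Set
  ult R S₁ S₂ d =
    (∀ S → S₁ ⊆ᵇ S → S ⊆ᵇ S₂ → R S d) ,
    Σ (_ → Bool) (λ S → S₁ ⊆ᵇ S × S ⊆ᵇ S₂ × R S d)

  val : Interp → Interp → ∀ {Γ} → Formula Γ → Env Γ → Set × Set
  val I₁ I₂ (atom p ts) ρ = (pred p (evalTs ts ρ)) , (pred p (evalTs ts ρ))
  val I₁ I₂ (defAtom {ss} p ts) ρ =
    (I₁ (ss , p , evalTs ts ρ) ≡ true) , (I₂ (ss , p , evalTs ts ρ) ≡ true)
  val I₁ I₂ (aggAtom R ⟨ ψ ⟩ t) ρ =
    ult (agg R) (λ ds → ⌊ proj₁ (val I₁ I₂ ψ (++⁺ ds ρ)) ⌋)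
                (λ ds → ⌊ proj₂ (val I₁ I₂ ψ (++⁺ ds ρ)) ⌋)
                (evalT t ρ)
  val I₁ I₂ (neg φ) ρ = (¬ proj₂ (val I₁ I₂ φ ρ)) , (¬ proj₁ (val I₁ I₂ φ ρ))
  val I₁ I₂ (and φ ψ) ρ =
    (proj₁ (val I₁ I₂ φ ρ) × proj₁ (val I₁ I₂ ψ ρ)) ,
    (proj₂ (val I₁ I₂ φ ρ) × proj₂ (val I₁ I₂ ψ ρ))
  val I₁ I₂ (or φ ψ) ρ =
    (proj₁ (val I₁ I₂ φ ρ) ⊎ proj₁ (val I₁ I₂ ψ ρ)) ,
    (proj₂ (val I₁ I₂ φ ρ) ⊎ proj₂ (val I₁ I₂ ψ ρ))
  val I₁ I₂ (all s φ) ρ =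
    (∀ (d : Dom s) → proj₁ (val I₁ I₂ φ (d ∷ ρ))) ,
    (∀ (d : Dom s) → proj₂ (val I₁ I₂ φ (d ∷ ρ)))
  val I₁ I₂ (ex s φ) ρ =
    Σ (Dom s) (λ d → proj₁ (val I₁ I₂ φ (d ∷ ρ))) ,
    Σ (Dom s) (λ d → proj₂ (val I₁ I₂ φ (d ∷ ρ)))

  Φ¹ : Program → Interp → Interp → Interp
  Φ¹ P I₁ I₂ A = ⌊ Σ Rule (λ r → P r × Σ (Env (Rule.ctx r)) λ ρ →
                    head r ρ ≡ A × proj₁ (val I₁ I₂ (Rule.body r) ρ)) ⌋

  Φ² : Program → Interp → Interp → Interp
  Φ² P I₁ I₂ A = ⌊ Σ Rule (λ r → P r × Σ (Env (Rule.ctx r)) λ ρ →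
                    head r ρ ≡ A × proj₂ (val I₁ I₂ (Rule.body r) ρ)) ⌋

  -- A↓(b) = glb { x ≤ b ∣ A¹(x,b) ≤ x }
  Down : Program → Interp → Base → Set
  Down P b A = ∀ (x : Interp) → x ⊆ b → Φ¹ P x b ⊆ x → x A ≡ true

  -- A↑(a) = glb { x ≥ a ∣ A²(a,x) ≤ x }
  Up : Program → Interp → Base → Set
  Up P a A = ∀ (x : Interp) → a ⊆ x → Φ² P a x ⊆ x → x A ≡ true

  StableFix : Program → Interp → Interp → Set
  StableFix P a b = (Down P b ≐ₚ ⌜ a ⌝) × (Up P a ≐ₚ ⌜ b ⌝)

  Admissible : Program → Interp → Interp → Set
  Admissible P a b =
    a ⊆ b × (a ⊆ Φ¹ P a b × Φ² P a b ⊆ b) × (⌜ a ⌝ ⊆ₚ Down P b)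

  WellFounded : Program → Interp → Interp → Set
  WellFounded P a b =
    Admissible P a b × StableFix P a b ×
    (∀ a' b' → Admissible P a' b' → StableFix P a' b' → a ⊆ a' × b' ⊆ b)

  StableModel : Program → Interp → Set
  StableModel P x = StableFix P x x

  LeastFixpoint : (Interp → Interp) → Interp → Set
  LeastFixpoint F M = (F M ≐ M) × (∀ X → F X ≐ X → M ⊆ X)

{-# OPTIONS --safe #-}
-- On a consistent pair (I₁ , I₂) the three-valued value of a positive formula is
-- (truth in I₁ , truth in I₂), and that of a negative one is (truth in I₂ , truth in I₁):
-- ult of a monotone (anti-monotone) aggregate relation is decided at the lower (upper)
-- bound of the three-valued set, and the condition of a neutral aggregate mentions no
-- defined predicate. Hence, for a definite program, Φ¹(x , b) = T(x) when x ⊆ b and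
-- Φ²(a , x) = T(x) when a ⊆ x, while consistency of the valuation makes T monotone.
-- So A↓(b) and A↑(a) are least prefixpoints of T below b and above a; lfp T lies below
-- every A↓(b) and above A↑(a) once a ⊆ lfp T, which squeezes every stable fixpoint
-- (a , b) into lfp T ⊆ a ⊆ b ⊆ lfp T.
module Submission where

open import Defs
open import Level using (0ℓ)
open import Data.Bool using (Bool; true)
open import Data.Bool.Properties using (⇔→≡)
open import Data.List using (List; _++_)
open import Data.List.Relation.Unary.All using (All; _∷_)
open import Data.List.Relation.Unary.All.Properties using (++⁺)
open import Data.Product using (Σ; ∃; _×_; _,_; proj₁; proj₂; map; map₂)
open import Data.Product.Function.NonDependent.Propositional using (_×-⇔_)
open import Data.Sum as Sum using (_⊎_)
open import Data.Sum.Function.Propositional using (_⊎-⇔_)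
open import Function using (_∘_)
open import Function.Bundles using (_⇔_; mk⇔; Equivalence)
import Function.Properties.Equivalence as ⇔
open import Function.Related.Propositional using (equivalence)
open import Function.Related.TypeIsomorphisms using (¬-cong-⇔)
import Data.Product.Function.Dependent.Propositional as Σ
open import Relation.Nullary using (¬_; yes; no)
open import Relation.Nullary.Decidable using (dec-true; does-⇔)
open import Relation.Binary.PropositionalEquality using (_≡_; _≗_; sym; trans)
open import Axiom.ExcludedMiddle using (ExcludedMiddle)

open Equivalence using (to; from)

⊆ᵇ-refl : {X : Set} {S : X → Bool} → S ⊆ᵇ S
⊆ᵇ-refl _ e = e

∀-cong-⇔ : {X : Set} {A B : X → Set} → (∀ x → A x ⇔ B x) → (∀ x → A x) ⇔ (∀ x → B x)
∀-cong-⇔ A⇔B = mk⇔ (λ f x → to (A⇔B x) (f x)) (λ f x → from (A⇔B x) (f x))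

infix 4 _≋_
infix 8 ¬₃_
infixr 7 _∧₃_
infixr 6 _∨₃_

_≋_ : Set × Set → Set × Set → Set
v ≋ w = (proj₁ v ⇔ proj₁ w) × (proj₂ v ⇔ proj₂ w)

≋-trans : ∀ {u v w} → u ≋ v → v ≋ w → u ≋ w
≋-trans (p₁ , p₂) (q₁ , q₂) = ⇔.trans p₁ q₁ , ⇔.trans p₂ q₂

¬₃_ : Set × Set → Set × Set
¬₃ v = (¬ proj₂ v) , (¬ proj₁ v)

_∧₃_ : Set × Set → Set × Set → Set × Set
v ∧₃ w = (proj₁ v × proj₁ w) , (proj₂ v × proj₂ w)

_∨₃_ : Set × Set → Set × Set → Set × Set
v ∨₃ w = (proj₁ v ⊎ proj₁ w) , (proj₂ v ⊎ proj₂ w)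

⋀₃ : {X : Set} → (X → Set × Set) → Set × Set
⋀₃ f = (∀ x → proj₁ (f x)) , (∀ x → proj₂ (f x))

⋁₃ : {X : Set} → (X → Set × Set) → Set × Set
⋁₃ f = Σ _ (proj₁ ∘ f) , Σ _ (proj₂ ∘ f)

¬₃-cong : ∀ {v w} → v ≋ w → ¬₃ v ≋ ¬₃ w
¬₃-cong (p₁ , p₂) = ¬-cong-⇔ p₂ , ¬-cong-⇔ p₁

∧₃-cong : ∀ {v v′ w w′} → v ≋ v′ → w ≋ w′ → v ∧₃ w ≋ v′ ∧₃ w′
∧₃-cong (p₁ , p₂) (q₁ , q₂) = (p₁ ×-⇔ q₁) , (p₂ ×-⇔ q₂)

∨₃-cong : ∀ {v v′ w w′} → v ≋ v′ → w ≋ w′ → v ∨₃ w ≋ v′ ∨₃ w′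
∨₃-cong (p₁ , p₂) (q₁ , q₂) = (p₁ ⊎-⇔ q₁) , (p₂ ⊎-⇔ q₂)

⋀₃-cong : {X : Set} {f g : X → Set × Set} → (∀ x → f x ≋ g x) → ⋀₃ f ≋ ⋀₃ g
⋀₃-cong f≋g = ∀-cong-⇔ (proj₁ ∘ f≋g) , ∀-cong-⇔ (proj₂ ∘ f≋g)

⋁₃-cong : {X : Set} {f g : X → Set × Set} → (∀ x → f x ≋ g x) → ⋁₃ f ≋ ⋁₃ g
⋁₃-cong f≋g =
  Σ.congˡ {k = equivalence} (proj₁ (f≋g _)) , Σ.congˡ {k = equivalence} (proj₂ (f≋g _))

module AggregateSemantics (Sg : Signature) (Π : List (Signature.Sort Sg) → Set)
                          (D : Structure Sg) (lem : ExcludedMiddle 0ℓ) where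
  open Signature Sg
  open Structure D
  open Syntax Sg Π
  open Polarity D
  open Semantics Sg Π D lem

  ⌊⌋-sound : ∀ {A} → ⌊ A ⌋ ≡ true → A
  ⌊⌋-sound {A} with lem {A}
  ... | yes a = λ _ → a
  ... | no _ = λ ()

  ⌊⌋-complete : ∀ {A} → A → ⌊ A ⌋ ≡ true
  ⌊⌋-complete = dec-true lem

  ⌊⌋-mono : ∀ {A B} → (A → B) → ⌊ A ⌋ ≡ true → ⌊ B ⌋ ≡ true
  ⌊⌋-mono A⇒B = ⌊⌋-complete ∘ A⇒B ∘ ⌊⌋-sound

  ⌊⌋-cong : ∀ {A B} → A ⇔ B → ⌊ A ⌋ ≡ ⌊ B ⌋
  ⌊⌋-cong A⇔B = does-⇔ A⇔B lem lem

  ⊆-trans : ∀ {I J K} → I ⊆ J → J ⊆ K → I ⊆ K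
  ⊆-trans I⊆J J⊆K A = J⊆K A ∘ I⊆J A

  ⊆-antisym : ∀ {I J} → I ⊆ J → J ⊆ I → I ≐ J
  ⊆-antisym I⊆J J⊆I A = ⇔→≡ (mk⇔ (I⊆J A) (J⊆I A))

  module _ {X Y : Set} {R : AggRel X Y} {S₁ S₂ : X → Bool} {d : Y} where

    ult-consistent : S₁ ⊆ᵇ S₂ → proj₁ (ult R S₁ S₂ d) → proj₂ (ult R S₁ S₂ d)
    ult-consistent S₁⊆S₂ r = S₁ , ⊆ᵇ-refl , S₁⊆S₂ , r S₁ ⊆ᵇ-refl S₁⊆S₂

    ult-monotone : Monotone R → S₁ ⊆ᵇ S₂ → ult R S₁ S₂ d ≋ (R S₁ d , R S₂ d)
    ult-monotone mono S₁⊆S₂ =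
      mk⇔ (λ r → r S₁ ⊆ᵇ-refl S₁⊆S₂) (λ r S S₁⊆S _ → mono _ _ _ r S₁⊆S) ,
      mk⇔ (λ (_ , _ , S⊆S₂ , r) → mono _ _ _ r S⊆S₂) (λ r → S₂ , S₁⊆S₂ , ⊆ᵇ-refl , r)

    ult-antitone : AntiMonotone R → S₁ ⊆ᵇ S₂ → ult R S₁ S₂ d ≋ (R S₂ d , R S₁ d)
    ult-antitone anti S₁⊆S₂ =
      mk⇔ (λ r → r S₂ S₁⊆S₂ ⊆ᵇ-refl) (λ r S _ S⊆S₂ → anti _ _ _ r S⊆S₂) ,
      mk⇔ (λ (_ , S₁⊆S , _ , r) → anti _ _ _ r S₁⊆S) (λ r → S₁ , ⊆ᵇ-refl , S₁⊆S₂ , r)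

    ult-exact : (∀ S S′ y → S ≗ S′ → R S y → R S′ y) → S₁ ≗ S₂ →
                ult R S₁ S₂ d ≋ (R S₁ d , R S₂ d)
    ult-exact ext S₁≗S₂ =
      mk⇔ (λ r → r S₁ ⊆ᵇ-refl S₁⊆S₂) (λ r S S₁⊆S S⊆S₂ → ext _ _ _ (squeeze S₁⊆S S⊆S₂) r) ,
      mk⇔ (λ (S , S₁⊆S , S⊆S₂ , r) →
             ext _ _ _ (λ x → trans (sym (squeeze S₁⊆S S⊆S₂ x)) (S₁≗S₂ x)) r)
          (λ r → S₂ , S₁⊆S₂ , ⊆ᵇ-refl , r)
      where
      S₁⊆S₂ : S₁ ⊆ᵇ S₂
      S₁⊆S₂ x e = trans (sym (S₁≗S₂ x)) e
      squeeze : ∀ {S} → S₁ ⊆ᵇ S → S ⊆ᵇ S₂ → S₁ ≗ S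
      squeeze S₁⊆S S⊆S₂ x = ⇔→≡ (mk⇔ (S₁⊆S x) (λ e → trans (S₁≗S₂ x) (S⊆S₂ x e)))

  agg-cong : ∀ {ss w} (R : Agg ss w) {A B : All Dom ss → Set} {d} → (∀ ds → A ds ⇔ B ds) →
             agg R (λ ds → ⌊ A ds ⌋) d ⇔ agg R (λ ds → ⌊ B ds ⌋) d
  agg-cong R A⇔B = mk⇔ (agg-ext R _ _ _ (λ ds → ⌊⌋-cong (A⇔B ds)))
                       (agg-ext R _ _ _ (λ ds → ⌊⌋-cong (⇔.sym (A⇔B ds))))

  module _ {I₁ I₂ : Interp} where

    val-consistent : I₁ ⊆ I₂ → ∀ {Γ} (φ : Formula Γ) ρ →
                     proj₁ (val I₁ I₂ φ ρ) → proj₂ (val I₁ I₂ φ ρ)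
    val-consistent I₁⊆I₂ (atom p ts) ρ = λ h → h
    val-consistent I₁⊆I₂ (defAtom p ts) ρ = I₁⊆I₂ _
    val-consistent I₁⊆I₂ (aggAtom R ⟨ ψ ⟩ t) ρ =
      ult-consistent {R = agg R} (λ ds → ⌊⌋-mono (val-consistent I₁⊆I₂ ψ (++⁺ ds ρ)))
    val-consistent I₁⊆I₂ (neg φ) ρ = λ ¬v₂ v₁ → ¬v₂ (val-consistent I₁⊆I₂ φ ρ v₁)
    val-consistent I₁⊆I₂ (and φ ψ) ρ = map (val-consistent I₁⊆I₂ φ ρ) (val-consistent I₁⊆I₂ ψ ρ)
    val-consistent I₁⊆I₂ (or φ ψ) ρ = Sum.map (val-consistent I₁⊆I₂ φ ρ) (val-consistent I₁⊆I₂ ψ ρ)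
    val-consistent I₁⊆I₂ (all s φ) ρ = λ h d → val-consistent I₁⊆I₂ φ (d ∷ ρ) (h d)
    val-consistent I₁⊆I₂ (ex s φ) ρ = map₂ (val-consistent I₁⊆I₂ φ (_ ∷ ρ))

    Agrees : Interp → Interp → ∀ {Γ} → Formula Γ → Env Γ → Set
    Agrees J₁ J₂ φ ρ = val I₁ I₂ φ ρ ≋ (sat J₁ φ ρ , sat J₂ φ ρ)

    module _ {Γ ss w} (R : Agg ss w) (ψ : Formula (ss ++ Γ)) (t : Term Γ w) {ρ : Env Γ} where

      val-aggAtom-monotone : ∀ {J₁ J₂} → I₁ ⊆ I₂ → Monotone (agg R) →
        (∀ ds → Agrees J₁ J₂ ψ (++⁺ ds ρ)) → Agrees J₁ J₂ (aggAtom R ⟨ ψ ⟩ t) ρ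
      val-aggAtom-monotone I₁⊆I₂ mono ψ≋ =
        ≋-trans (ult-monotone {R = agg R} mono (λ ds → ⌊⌋-mono (val-consistent I₁⊆I₂ ψ (++⁺ ds ρ))))
                (agg-cong R (proj₁ ∘ ψ≋) , agg-cong R (proj₂ ∘ ψ≋))

      val-aggAtom-antitone : ∀ {J₁ J₂} → I₁ ⊆ I₂ → AntiMonotone (agg R) →
        (∀ ds → Agrees J₁ J₂ ψ (++⁺ ds ρ)) → Agrees J₂ J₁ (aggAtom R ⟨ ψ ⟩ t) ρ
      val-aggAtom-antitone I₁⊆I₂ anti ψ≋ =
        ≋-trans (ult-antitone {R = agg R} anti (λ ds → ⌊⌋-mono (val-consistent I₁⊆I₂ ψ (++⁺ ds ρ))))
                (agg-cong R (proj₂ ∘ ψ≋) , agg-cong R (proj₁ ∘ ψ≋))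

      val-aggAtom-exact : ∀ {J} →
        (∀ ds → Agrees J J ψ (++⁺ ds ρ)) → Agrees J J (aggAtom R ⟨ ψ ⟩ t) ρ
      val-aggAtom-exact ψ≋ =
        ≋-trans (ult-exact {R = agg R} (agg-ext R)
                   (λ ds → ⌊⌋-cong (⇔.trans (proj₁ (ψ≋ ds)) (⇔.sym (proj₂ (ψ≋ ds))))))
                (agg-cong R (proj₁ ∘ ψ≋) , agg-cong R (proj₂ ∘ ψ≋))

    val-noDef : ∀ {Γ} {φ : Formula Γ} → NoDef φ → ∀ J ρ → Agrees J J φ ρ
    val-noDef (atom p ts) J ρ = ⇔.refl , ⇔.refl
    val-noDef (aggN R {ψ} t ψ⁰) J ρ = val-aggAtom-exact R ψ t (λ ds → val-noDef ψ⁰ J (++⁺ ds ρ))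
    val-noDef (neg φ⁰) J ρ = ¬₃-cong (val-noDef φ⁰ J ρ)
    val-noDef (and φ⁰ ψ⁰) J ρ = ∧₃-cong (val-noDef φ⁰ J ρ) (val-noDef ψ⁰ J ρ)
    val-noDef (or φ⁰ ψ⁰) J ρ = ∨₃-cong (val-noDef φ⁰ J ρ) (val-noDef ψ⁰ J ρ)
    val-noDef (all s φ⁰) J ρ = ⋀₃-cong (λ d → val-noDef φ⁰ J (d ∷ ρ))
    val-noDef (ex s φ⁰) J ρ = ⋁₃-cong (λ d → val-noDef φ⁰ J (d ∷ ρ))

    module _ (I₁⊆I₂ : I₁ ⊆ I₂) where
      mutual
        val-pos : ∀ {Γ} {φ : Formula Γ} → Pos φ → ∀ ρ → Agrees I₁ I₂ φ ρ
        val-pos (atom p ts) ρ = ⇔.refl , ⇔.refl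
        val-pos (def p ts) ρ = ⇔.refl , ⇔.refl
        val-pos (aggAnti R {ψ} t anti ψ⁻) ρ =
          val-aggAtom-antitone R ψ t I₁⊆I₂ anti (λ ds → val-neg ψ⁻ (++⁺ ds ρ))
        val-pos (aggMono R {ψ} t _ mono ψ⁺) ρ =
          val-aggAtom-monotone R ψ t I₁⊆I₂ mono (λ ds → val-pos ψ⁺ (++⁺ ds ρ))
        val-pos (aggNeutral R t _ _ ψ⁰) ρ =
          proj₁ (val-noDef (aggN R t ψ⁰) I₁ ρ) , proj₂ (val-noDef (aggN R t ψ⁰) I₂ ρ)
        val-pos (neg φ⁻) ρ = ¬₃-cong (val-neg φ⁻ ρ)
        val-pos (and φ⁺ ψ⁺) ρ = ∧₃-cong (val-pos φ⁺ ρ) (val-pos ψ⁺ ρ)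
        val-pos (or φ⁺ ψ⁺) ρ = ∨₃-cong (val-pos φ⁺ ρ) (val-pos ψ⁺ ρ)
        val-pos (all s φ⁺) ρ = ⋀₃-cong (λ d → val-pos φ⁺ (d ∷ ρ))
        val-pos (ex s φ⁺) ρ = ⋁₃-cong (λ d → val-pos φ⁺ (d ∷ ρ))

        val-neg : ∀ {Γ} {φ : Formula Γ} → Neg φ → ∀ ρ → Agrees I₂ I₁ φ ρ
        val-neg (atom p ts) ρ = ⇔.refl , ⇔.refl
        val-neg (aggAnti R {ψ} t anti ψ⁺) ρ =
          val-aggAtom-antitone R ψ t I₁⊆I₂ anti (λ ds → val-pos ψ⁺ (++⁺ ds ρ))
        val-neg (aggMono R {ψ} t _ mono ψ⁻) ρ =
          val-aggAtom-monotone R ψ t I₁⊆I₂ mono (λ ds → val-neg ψ⁻ (++⁺ ds ρ))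
        val-neg (aggNeutral R t _ _ ψ⁰) ρ =
          proj₁ (val-noDef (aggN R t ψ⁰) I₂ ρ) , proj₂ (val-noDef (aggN R t ψ⁰) I₁ ρ)
        val-neg (neg φ⁺) ρ = ¬₃-cong (val-pos φ⁺ ρ)
        val-neg (and φ⁻ ψ⁻) ρ = ∧₃-cong (val-neg φ⁻ ρ) (val-neg ψ⁻ ρ)
        val-neg (or φ⁻ ψ⁻) ρ = ∨₃-cong (val-neg φ⁻ ρ) (val-neg ψ⁻ ρ)
        val-neg (all s φ⁻) ρ = ⋀₃-cong (λ d → val-neg φ⁻ (d ∷ ρ))
        val-neg (ex s φ⁻) ρ = ⋁₃-cong (λ d → val-neg φ⁻ (d ∷ ρ))

  sat-mono : ∀ {I J Γ} {φ : Formula Γ} → Pos φ → I ⊆ J → ∀ ρ → sat I φ ρ → sat J φ ρ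
  sat-mono {I} {J} {φ = φ} φ⁺ I⊆J ρ =
    to (proj₂ φ≋) ∘ val-consistent I⊆J φ ρ ∘ from (proj₁ φ≋)
    where
    φ≋ : Agrees {I} {J} I J φ ρ
    φ≋ = val-pos I⊆J φ⁺ ρ

  Derivable : Program → ((r : Rule) → Env (Rule.ctx r) → Set) → Base → Set
  Derivable P B A = Σ Rule λ r → P r × Σ (Env (Rule.ctx r)) λ ρ → head r ρ ≡ A × B r ρ

  Derivable-map : ∀ {P B B′ A} → (∀ r → P r → ∀ ρ → B r ρ → B′ r ρ) →
                  Derivable P B A → Derivable P B′ A
  Derivable-map B⇒B′ (r , r∈P , ρ , A≡head , b) = r , r∈P , ρ , A≡head , B⇒B′ r r∈P ρ b

  Derivable-cong : ∀ {P B B′ A} → (∀ r → P r → ∀ ρ → B r ρ ⇔ B′ r ρ) →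
                   Derivable P B A ⇔ Derivable P B′ A
  Derivable-cong B⇔B′ = mk⇔ (Derivable-map λ r r∈P ρ → to (B⇔B′ r r∈P ρ))
                            (Derivable-map λ r r∈P ρ → from (B⇔B′ r r∈P ρ))

  module KnasterTarski (F : Interp → Interp) (F-mono : ∀ {I J} → I ⊆ J → F I ⊆ F J) where

    lfp : Interp
    lfp A = ⌊ (∀ X → F X ⊆ X → X A ≡ true) ⌋

    lfp-least : ∀ {X} → F X ⊆ X → lfp ⊆ X
    lfp-least {X} FX⊆X A A∈lfp = ⌊⌋-sound A∈lfp X FX⊆X

    lfp-prefixed : F lfp ⊆ lfp
    lfp-prefixed A A∈F-lfp = ⌊⌋-complete λ X FX⊆X → FX⊆X A (F-mono (lfp-least FX⊆X) A A∈F-lfp)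

    lfp-postfixed : lfp ⊆ F lfp
    lfp-postfixed = lfp-least (F-mono lfp-prefixed)

    lfp-leastFixpoint : LeastFixpoint F lfp
    lfp-leastFixpoint =
      ⊆-antisym lfp-prefixed lfp-postfixed ,
      λ X FX≐X → lfp-least λ A A∈FX → trans (sym (FX≐X A)) A∈FX

  ⊆Up : ∀ {P a} → ⌜ a ⌝ ⊆ₚ Up P a
  ⊆Up A A∈a x a⊆x _ = a⊆x A A∈a

  module DefiniteProgram (P : Program) (definite : Definite P) where

    T-mono : ∀ {I J} → I ⊆ J → T P I ⊆ T P J
    T-mono I⊆J A = ⌊⌋-mono (Derivable-map λ r r∈P ρ → sat-mono (definite r r∈P) I⊆J ρ)

    Φ¹≐T : ∀ {x b} → x ⊆ b → Φ¹ P x b ≐ T P x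
    Φ¹≐T x⊆b A = ⌊⌋-cong (Derivable-cong λ r r∈P ρ → proj₁ (val-pos x⊆b (definite r r∈P) ρ))

    Φ²≐T : ∀ {a x} → a ⊆ x → Φ² P a x ≐ T P x
    Φ²≐T a⊆x A = ⌊⌋-cong (Derivable-cong λ r r∈P ρ → proj₂ (val-pos a⊆x (definite r r∈P) ρ))

    open KnasterTarski (T P) T-mono public

    lfp⊆Down : ∀ {b} → ⌜ lfp ⌝ ⊆ₚ Down P b
    lfp⊆Down A A∈lfp x x⊆b Φ¹x⊆x =
      lfp-least (λ B B∈Tx → Φ¹x⊆x B (trans (Φ¹≐T x⊆b B) B∈Tx)) A A∈lfp

    Down⊆lfp : ∀ {b} → lfp ⊆ b → Down P b ⊆ₚ ⌜ lfp ⌝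
    Down⊆lfp lfp⊆b A A∈Down =
      A∈Down lfp lfp⊆b λ B B∈Φ¹ → lfp-prefixed B (trans (sym (Φ¹≐T lfp⊆b B)) B∈Φ¹)

    Up⊆lfp : ∀ {a} → a ⊆ lfp → Up P a ⊆ₚ ⌜ lfp ⌝
    Up⊆lfp a⊆lfp A A∈Up =
      A∈Up lfp a⊆lfp λ B B∈Φ² → lfp-prefixed B (trans (sym (Φ²≐T a⊆lfp B)) B∈Φ²)

    module _ {a b : Interp} where

      stableFix⇒lfp⊆lower : StableFix P a b → lfp ⊆ a
      stableFix⇒lfp⊆lower ((Down⊆a , _) , _) A A∈lfp = Down⊆a A (lfp⊆Down A A∈lfp)

      stableFix⇒lower⊆upper : StableFix P a b → a ⊆ b
      stableFix⇒lower⊆upper (_ , (Up⊆b , _)) A A∈a = Up⊆b A (⊆Up A A∈a)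

      stableFix⇒lower⊆lfp : StableFix P a b → a ⊆ lfp
      stableFix⇒lower⊆lfp stable@((_ , a⊆Down) , _) A A∈a =
        Down⊆lfp lfp⊆b A (a⊆Down A A∈a)
        where
        lfp⊆b : lfp ⊆ b
        lfp⊆b = ⊆-trans (stableFix⇒lfp⊆lower stable) (stableFix⇒lower⊆upper stable)

      stableFix⇒upper⊆lfp : StableFix P a b → b ⊆ lfp
      stableFix⇒upper⊆lfp stable@(_ , (_ , b⊆Up)) A A∈b =
        Up⊆lfp (stableFix⇒lower⊆lfp stable) A (b⊆Up A A∈b)

    stableFix-lfp : StableFix P lfp lfp
    stableFix-lfp = (Down⊆lfp ⊆ᵇ-refl , lfp⊆Down) , (Up⊆lfp ⊆ᵇ-refl , ⊆Up)

    admissible-lfp : Admissible P lfp lfp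
    admissible-lfp =
      ⊆ᵇ-refl ,
      ((λ A A∈lfp → trans (Φ¹≐T ⊆ᵇ-refl A) (lfp-postfixed A A∈lfp)) ,
       (λ A A∈Φ² → lfp-prefixed A (trans (sym (Φ²≐T ⊆ᵇ-refl A)) A∈Φ²))) ,
      lfp⊆Down

theorem7 : (Sg : Signature) (D : Structure Sg) (Π : List (Signature.Sort Sg) → Set)
    (P : Syntax.Program Sg Π) (lem : ExcludedMiddle 0ℓ) →
    Syntax.Polarity.Definite Sg Π D P →
    ∃ λ (M : Semantics.Interp Sg Π D lem) →
    Semantics.WellFounded Sg Π D lem P M M
    × Semantics.StableModel Sg Π D lem P M
    × (∀ x → Semantics.StableModel Sg Π D lem P x → Semantics._≐_ Sg Π D lem x M)
    × Semantics.LeastFixpoint Sg Π D lem (Semantics.T Sg Π D lem P) M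
theorem7 Sg D Π P lem definite =
  lfp ,
  (admissible-lfp , stableFix-lfp ,
   λ _ _ _ stable → stableFix⇒lfp⊆lower stable , stableFix⇒upper⊆lfp stable) ,
  stableFix-lfp ,
  (λ x stable → ⊆-antisym (stableFix⇒upper⊆lfp stable) (stableFix⇒lfp⊆lower stable)) ,
  lfp-leastFixpoint
  where
  open AggregateSemantics Sg Π D lem using (⊆-antisym)
  open AggregateSemantics.DefiniteProgram Sg Π D lem P definite
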